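{- Let $F:\mathbb{N}^+\times\mathbb{N}^+\to\mathbb{N}^+$ be defined by $$F(m,n)=\frac{1}{4}\left[(m+n-1)^2-\big((m+n-1)\bmod 2\big)\right]+\min(m,n).$$ For an integer $i\ge 2$ let $S_i=\{(x,y)\in\mathbb{N}^+\times\mathbb{N}^+ : x+y=i,\ x\ge y\}$. If $2\le i<j$ are integers, $(x_1,y_1)\in S_i$ and $(x_2,y_2)\in S_j$, then $F(x_1,y_1)<F(x_2,y_2)$.
   Context: $\mathbb{N}^+$ denotes the set of positive integers. For an integer $k$, $k\bmod 2$ denotes the least non-negative residue of $k$ modulo $2$. -}

module Defs where

open import Data.Nat using (ℕ; _+_; _*_; _∸_; _⊓_; _≥_; _≤_)
open import Data.Nat.DivMod using (_/_; _%_)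
open import Data.Product using (_×_)
open import Relation.Binary.PropositionalEquality using (_≡_)

-- F(m,n) = ((m+n-1)^2 - ((m+n-1) mod 2)) / 4 + min(m,n)
-- (the numerator is always divisible by 4, so floor division is exact)
F : ℕ → ℕ → ℕ
F m n = ((k * k ∸ (k % 2)) / 4) + (m ⊓ n)
  where k = m + n ∸ 1

InS : ℕ → ℕ → ℕ → Set
InS i x y = (1 ≤ x) × (1 ≤ y) × (x + y ≡ i) × (x ≥ y)

-- Write k = x + y − 1, so that F x y = ⌊k²/4⌋ + y on S_{k+1}.  The sequence ⌊k²/4⌋
-- is 0, 0, 1, 2, 4, 6, 9, … and increases by ⌈k/2⌉ from k to k + 1.  Since x ≥ y gives
-- 2y ≤ k + 1, i.e. y ≤ ⌈k/2⌉, every value of F on S_{k+1} is at most ⌊(k+1)²/4⌋, while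
-- every value of F on a later S_j exceeds ⌊(j−1)²/4⌋ ≥ ⌊(k+1)²/4⌋ because y ≥ 1.
module Submission where

open import Defs
open import Data.Nat
open import Data.Nat.Properties
open import Data.Nat.DivMod using (_/_; _%_; m*n/n≡m; m*n%n≡0; [m+kn]%n≡m%n)
open import Data.Nat.Solver using (module +-*-Solver)
open import Data.Product using (_,_; ∃)
open import Data.Sum using (_⊎_; inj₁; inj₂)
open import Function using (_∘_)
open import Relation.Binary.Core using (_Preserves_⟶_)
open import Relation.Binary.PropositionalEquality
open +-*-Solver using (solve; _:+_; _:*_; _:=_; con)

quarterSquare : ℕ → ℕ
quarterSquare k = (k * k ∸ k % 2) / 4

even⊎odd : ∀ k → (∃ λ m → k ≡ m + m) ⊎ (∃ λ m → k ≡ suc (m + m))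
even⊎odd zero = inj₁ (0 , refl)
even⊎odd (suc k) with even⊎odd k
... | inj₁ (m , refl) = inj₂ (m , refl)
... | inj₂ (m , refl) = inj₁ (suc m , cong suc (sym (+-suc m m)))

quarterSquare-even : ∀ m → quarterSquare (m + m) ≡ m * m
quarterSquare-even m = begin
  ((m + m) * (m + m) ∸ (m + m) % 2) / 4 ≡⟨ cong (λ t → ((m + m) * (m + m) ∸ t % 2) / 4) m+m≡m*2 ⟩
  ((m + m) * (m + m) ∸ (m * 2) % 2) / 4 ≡⟨ cong (λ r → ((m + m) * (m + m) ∸ r) / 4) (m*n%n≡0 m 2) ⟩
  ((m + m) * (m + m)) / 4               ≡⟨ cong (_/ 4) square≡ ⟩
  (m * m * 4) / 4                       ≡⟨ m*n/n≡m (m * m) 4 ⟩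
  m * m                                 ∎
  where
  open ≡-Reasoning
  m+m≡m*2 : m + m ≡ m * 2
  m+m≡m*2 = solve 1 (λ m → m :+ m := m :* con 2) refl m
  square≡ : (m + m) * (m + m) ≡ m * m * 4
  square≡ = solve 1 (λ m → (m :+ m) :* (m :+ m) := m :* m :* con 4) refl m

quarterSquare-odd : ∀ m → quarterSquare (suc (m + m)) ≡ m * m + m
quarterSquare-odd m = begin
  (k * k ∸ k % 2) / 4          ≡⟨ cong (λ t → (k * k ∸ t % 2) / 4) k≡1+m*2 ⟩
  (k * k ∸ (1 + m * 2) % 2) / 4 ≡⟨ cong (λ r → (k * k ∸ r) / 4) ([m+kn]%n≡m%n 1 m 2) ⟩
  (k * k ∸ 1) / 4              ≡⟨ cong (λ t → (t ∸ 1) / 4) square≡ ⟩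
  (m * m + m) * 4 / 4          ≡⟨ m*n/n≡m (m * m + m) 4 ⟩
  m * m + m                    ∎
  where
  open ≡-Reasoning
  k = suc (m + m)
  k≡1+m*2 : k ≡ 1 + m * 2
  k≡1+m*2 = solve 1 (λ m → con 1 :+ (m :+ m) := con 1 :+ m :* con 2) refl m
  square≡ : k * k ≡ suc ((m * m + m) * 4)
  square≡ = solve 1 (λ m → (con 1 :+ (m :+ m)) :* (con 1 :+ (m :+ m))
                         := con 1 :+ (m :* m :+ m) :* con 4) refl m

y+y≤1+m+m⇒y≤m : ∀ y m → y + y ≤ suc (m + m) → y ≤ m
y+y≤1+m+m⇒y≤m y m y+y≤ = ≮⇒≥ λ m<y →
  <⇒≱ (subst (_≤ y + y) (cong suc (+-suc m m)) (+-mono-≤ m<y m<y)) y+y≤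

quarterSquare-step : ∀ k y → y + y ≤ suc k → quarterSquare k + y ≤ quarterSquare (suc k)
quarterSquare-step k y y+y≤ with even⊎odd k
... | inj₁ (m , refl) = begin
  quarterSquare (m + m) + y       ≡⟨ cong (_+ y) (quarterSquare-even m) ⟩
  m * m + y                       ≤⟨ +-monoʳ-≤ (m * m) (y+y≤1+m+m⇒y≤m y m y+y≤) ⟩
  m * m + m                       ≡⟨ quarterSquare-odd m ⟨
  quarterSquare (suc (m + m))     ∎
  where open ≤-Reasoning
... | inj₂ (m , refl) = begin
  quarterSquare (suc (m + m)) + y ≡⟨ cong (_+ y) (quarterSquare-odd m) ⟩
  m * m + m + y                   ≤⟨ +-monoʳ-≤ (m * m + m) y≤1+m ⟩
  m * m + m + suc m               ≡⟨ solve 1 (λ m → m :* m :+ m :+ (con 1 :+ m)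
                                                 := (con 1 :+ m) :* (con 1 :+ m)) refl m ⟩
  suc m * suc m                   ≡⟨ quarterSquare-even (suc m) ⟨
  quarterSquare (suc m + suc m)   ≡⟨ cong (quarterSquare ∘ suc) (+-suc m m) ⟩
  quarterSquare (suc (suc (m + m))) ∎
  where
  open ≤-Reasoning
  y≤1+m : y ≤ suc m
  y≤1+m = y+y≤1+m+m⇒y≤m y (suc m)
            (m≤n⇒m≤1+n (subst (y + y ≤_) (cong suc (sym (+-suc m m))) y+y≤))

quarterSquare-mono-≤ : quarterSquare Preserves _≤_ ⟶ _≤_
quarterSquare-mono-≤ {a} {b} a≤b with m≤n⇒m<n∨m≡n a≤b
... | inj₂ refl = ≤-refl
... | inj₁ (s≤s {n = b′} a≤b′) =
  ≤-trans (quarterSquare-mono-≤ a≤b′) (≤-trans (m≤m+n _ 0) (quarterSquare-step b′ 0 z≤n))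

F-on-S : ∀ k x y → InS (suc k) x y → F x y ≡ quarterSquare k + y
F-on-S k x y (_ , _ , x+y≡1+k , y≤x) =
  cong₂ (λ s t → quarterSquare (s ∸ 1) + t) x+y≡1+k (m≥n⇒m⊓n≡n y≤x)

twice-second-≤-on-S : ∀ i x y → InS i x y → y + y ≤ i
twice-second-≤-on-S i x y (_ , _ , x+y≡i , y≤x) = subst (y + y ≤_) x+y≡i (+-monoˡ-≤ y y≤x)

lemma4 : (i j x₁ y₁ x₂ y₂ : ℕ) → 2 ≤ i → i < j →
    InS i x₁ y₁ → InS j x₂ y₂ → F x₁ y₁ < F x₂ y₂
lemma4 (suc k) (suc l) x₁ y₁ x₂ y₂ _ (s≤s k<l) S₁ S₂@(_ , 1≤y₂ , _) = begin-strict
  F x₁ y₁               ≡⟨ F-on-S k x₁ y₁ S₁ ⟩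
  quarterSquare k + y₁  ≤⟨ quarterSquare-step k y₁ (twice-second-≤-on-S (suc k) x₁ y₁ S₁) ⟩
  quarterSquare (suc k) ≤⟨ quarterSquare-mono-≤ k<l ⟩
  quarterSquare l       <⟨ m<m+n (quarterSquare l) 1≤y₂ ⟩
  quarterSquare l + y₂  ≡⟨ F-on-S l x₂ y₂ S₂ ⟨
  F x₂ y₂               ∎
  where open ≤-Reasoning
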